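{- Let $G=(V,E)$ be a finite simple graph. If $S\subseteq V$ is a maximal odd-cycle independent set, then $S$ is a minimal odd-cycle dominating set.
   Context: For $S\subseteq V$, $\langle S\rangle$ is the induced subgraph; maximal/minimal are with respect to inclusion. $S$ is odd-cycle independent if $\langle S\rangle$ contains no odd cycle. $S$ is odd-cycle dominating if for every $v\in V\setminus S$ there is $u\in S$ such that $u$ and $v$ lie on a common odd cycle of $\langle S\cup\{v\}\rangle$. -}

module Defs where

open import Data.Nat using (ℕ; zero; suc; _+_; _*_)
open import Data.Fin using (Fin; zero; suc; inject₁; fromℕ)
open import Data.Fin.Subset using (Subset; _∈_; _∉_; _⊂_; _∪_; ⁅_⁆)
open import Data.Product using (Σ; ∃; _×_; _,_)
open import Function.Definitions using (Injective)
open import Relation.Binary.PropositionalEquality using (_≡_)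
open import Relation.Nullary using (¬_; Dec)

record Graph (n : ℕ) : Set₁ where
  field
    Adj    : Fin n → Fin n → Set
    sym    : ∀ {u v} → Adj u v → Adj v u
    irrefl : ∀ {u} → ¬ Adj u u
    dec    : ∀ u v → Dec (Adj u v)

module _ {n : ℕ} (G : Graph n) where
  open Graph G

  -- A cycle of length suc m (m ≥ 2 ensured by callers) given by an injective
  -- vertex map c, with c i ~ c (i+1) and c m ~ c 0.
  IsCycle : (m : ℕ) → (Fin (suc m) → Fin n) → Set
  IsCycle m c =
    Injective _≡_ _≡_ c ×
    ((i : Fin m) → Adj (c (inject₁ i)) (c (suc i))) ×
    Adj (c (fromℕ m)) (c zero)

  record OddCycle : Set where
    field
      j      : ℕ
      vert   : Fin (3 + 2 * j) → Fin n
      cycle  : IsCycle (2 + 2 * j) vert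

  open OddCycle public

  InInduced : OddCycle → Subset n → Set
  InInduced C S = ∀ i → vert C i ∈ S

  OnCycle : Fin n → OddCycle → Set
  OnCycle v C = ∃ λ i → vert C i ≡ v

  OddCycleIndependent : Subset n → Set
  OddCycleIndependent S = ∀ (C : OddCycle) → ¬ InInduced C S

  OddCycleDominating : Subset n → Set
  OddCycleDominating S =
    ∀ v → v ∉ S →
      ∃ λ u → u ∈ S × Σ OddCycle λ C →
        InInduced C (S ∪ ⁅ v ⁆) × OnCycle u C × OnCycle v C

  MaximalOddCycleIndependent : Subset n → Set
  MaximalOddCycleIndependent S =
    OddCycleIndependent S × (∀ T → S ⊂ T → ¬ OddCycleIndependent T)

  MinimalOddCycleDominating : Subset n → Set
  MinimalOddCycleDominating S =
    OddCycleDominating S × (∀ T → T ⊂ S → ¬ OddCycleDominating T)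

-- Maximality of an odd-cycle independent set S means that for every v ∉ S the
-- set S ∪ {v} carries an odd cycle; since S itself carries none, that cycle
-- passes through v, and any other vertex u of it lies in S. Minimality: if
-- T ⊂ S were dominating, a vertex x ∈ S ∖ T would lie on an odd cycle inside
-- T ∪ {x} ⊆ S, contradicting independence of S. Constructively, the witness
-- cycle in S ∪ {v} is obtained because "⟨ T ⟩ has an odd cycle" is decidable
-- by exhaustive search: the cycle has length at most n.
module Submission where

open import Defs
open import Data.Nat using (ℕ; zero; suc; _+_; _*_; _<_; _≤_; s≤s)
open import Data.Nat.Properties using (≤-trans; <-≤-trans; m≤m+n; m≤n+m)
open import Data.Fin using (Fin; zero; suc; toℕ; fromℕ<; punchIn)
open import Data.Fin.Properties using (any?; all?; _≟_; toℕ-fromℕ<; injective⇒≤; punchInᵢ≢i)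
open import Data.Fin.Subset using (Subset; _∈_; _∉_; _⊆_; _⊂_; _∪_; ⁅_⁆)
open import Data.Fin.Subset.Properties using (_∈?_; x∈p∪q⁻; p⊆p∪q; q⊆p∪q; x∈⁅x⁆; x∈⁅y⁆⇒x≡y)
open import Data.Vec.Functional using (_∷_)
open import Data.Product using (Σ; ∃; _×_; _,_; proj₁)
open import Data.Sum using (inj₁; inj₂)
open import Function using (_∘_)
open import Function.Definitions using (Injective)
open import Relation.Nullary using (¬_; Dec; yes; no; contradiction)
open import Relation.Nullary.Decidable using (map′; _×-dec_; _→-dec_)
open import Relation.Binary.PropositionalEquality using (_≡_; _≢_; _≗_; refl; sym; trans; subst; subst₂)

any?-Fin→Fin : ∀ k {n} {P : (Fin k → Fin n) → Set} →
  (∀ {f g} → f ≗ g → P f → P g) → (∀ f → Dec (P f)) → Dec (∃ P)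
any?-Fin→Fin zero    resp P? = map′ (_ ,_) (λ (f , pf) → resp (λ ()) pf) (P? (λ ()))
any?-Fin→Fin (suc k) resp P? =
  map′ (λ (a , g , p) → a ∷ g , p)
       (λ (f , pf) → f zero , f ∘ suc , resp (λ { zero → refl ; (suc _) → refl }) pf)
       (any? λ a → any?-Fin→Fin k (λ f≗g → resp λ { zero → refl ; (suc x) → f≗g x })
                                  (P? ∘ (a ∷_)))

injective? : ∀ {m n} (f : Fin m → Fin n) → Dec (Injective _≡_ _≡_ f)
injective? f = map′ (λ inj {x} {y} → inj x y) (λ inj x y → inj)
  (all? λ x → all? λ y → (f x ≟ f y) →-dec (x ≟ y))

∈-∪⁅⁆⁻ : ∀ {n} {x y : Fin n} (p : Subset n) → x ∈ p ∪ ⁅ y ⁆ → x ≢ y → x ∈ p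
∈-∪⁅⁆⁻ {y = y} p x∈ x≢y with x∈p∪q⁻ p ⁅ y ⁆ x∈
... | inj₁ x∈p  = x∈p
... | inj₂ x∈⁅y⁆ = contradiction (x∈⁅y⁆⇒x≡y y x∈⁅y⁆) x≢y

∪⁅⁆-⊆ : ∀ {n} {p q : Subset n} {y : Fin n} → p ⊆ q → y ∈ q → p ∪ ⁅ y ⁆ ⊆ q
∪⁅⁆-⊆ {p = p} {y = y} p⊆q y∈q x∈ with x∈p∪q⁻ p ⁅ y ⁆ x∈
... | inj₁ x∈p   = p⊆q x∈p
... | inj₂ x∈⁅y⁆ = subst (_∈ _) (sym (x∈⁅y⁆⇒x≡y y x∈⁅y⁆)) y∈q

⊂-∪⁅⁆ : ∀ {n} {p : Subset n} {y : Fin n} → y ∉ p → p ⊂ p ∪ ⁅ y ⁆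
⊂-∪⁅⁆ {p = p} {y} y∉p = p⊆p∪q ⁅ y ⁆ , y , q⊆p∪q p ⁅ y ⁆ (x∈⁅x⁆ y) , y∉p

module _ {n : ℕ} (G : Graph n) where
  open Graph G using (Adj; dec)

  CycleIn : Subset n → (m : ℕ) → (Fin (suc m) → Fin n) → Set
  CycleIn T m c = IsCycle G m c × (∀ i → c i ∈ T)

  CycleIn-resp : ∀ {T m} {c d : Fin (suc m) → Fin n} → c ≗ d → CycleIn T m c → CycleIn T m d
  CycleIn-resp {T} c≗d ((inj , adj , closing) , inT) =
    ( (λ {x} {y} e → inj (trans (c≗d x) (trans e (sym (c≗d y)))))
    , (λ i → subst₂ Adj (c≗d _) (c≗d _) (adj i))
    , subst₂ Adj (c≗d _) (c≗d _) closing )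
    , (λ i → subst (_∈ T) (c≗d i) (inT i))

  cycleIn? : ∀ T m c → Dec (CycleIn T m c)
  cycleIn? T m c =
    (injective? c ×-dec all? (λ i → dec _ _) ×-dec dec _ _) ×-dec all? (λ i → c i ∈? T)

  OddCycleIn : Subset n → Set
  OddCycleIn T = Σ (OddCycle G) λ C → InInduced G C T

  oddCycle-j<n : (C : OddCycle G) → OddCycle.j C < n
  oddCycle-j<n C =
    <-≤-trans (s≤s (half≤length (OddCycle.j C))) (injective⇒≤ (proj₁ (cycle C)))
    where
    half≤length : ∀ j → j ≤ 2 + 2 * j
    half≤length j = ≤-trans (m≤m+n j (j + 0)) (m≤n+m (2 * j) 2)

  oddCycleIn? : ∀ T → Dec (OddCycleIn T)
  oddCycleIn? T = map′ fromSearch toSearch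
    (any? λ j → any?-Fin→Fin _ CycleIn-resp (cycleIn? T (2 + 2 * toℕ j)))
    where
    fromSearch : (∃ λ (j : Fin n) → ∃ (CycleIn T (2 + 2 * toℕ j))) → OddCycleIn T
    fromSearch (j , c , isCycle , inT) = record { j = toℕ j ; vert = c ; cycle = isCycle } , inT
    toSearch : OddCycleIn T → ∃ λ (j : Fin n) → ∃ (CycleIn T (2 + 2 * toℕ j))
    toSearch (C , inT) = fromℕ< (oddCycle-j<n C) ,
      subst (λ j → ∃ (CycleIn T (2 + 2 * j))) (sym (toℕ-fromℕ< (oddCycle-j<n C)))
            (vert C , cycle C , inT)

  module _ {S : Subset n} where

    maximal⇒oddCycleIn-∪⁅⁆ : MaximalOddCycleIndependent G S →
                             ∀ {v} → v ∉ S → OddCycleIn (S ∪ ⁅ v ⁆)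
    maximal⇒oddCycleIn-∪⁅⁆ (_ , maximal) {v} v∉S with oddCycleIn? (S ∪ ⁅ v ⁆)
    ... | yes cycleIn = cycleIn
    ... | no ¬cycleIn = contradiction (λ C inT → ¬cycleIn (C , inT)) (maximal _ (⊂-∪⁅⁆ v∉S))

    independent⇒onCycle : OddCycleIndependent G S →
                          ∀ {v} ((C , _) : OddCycleIn (S ∪ ⁅ v ⁆)) → OnCycle G v C
    independent⇒onCycle independent {v} (C , inT) with any? (λ i → vert C i ≟ v)
    ... | yes onCycle = onCycle
    ... | no ¬onCycle = contradiction (λ i → ∈-∪⁅⁆⁻ S (inT i) (¬onCycle ∘ (i ,_))) (independent C)

    otherVertexIn : ∀ {v} ((C , _) : OddCycleIn (S ∪ ⁅ v ⁆)) → OnCycle G v C →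
                    ∃ λ u → u ∈ S × OnCycle G u C
    otherVertexIn {v} (C , inT) (i , vᵢ≡v) = vert C k , ∈-∪⁅⁆⁻ S (inT k) vₖ≢v , k , refl
      where
      k : Fin _
      k = punchIn i zero
      vₖ≢v : vert C k ≢ v
      vₖ≢v vₖ≡v = punchInᵢ≢i i zero (proj₁ (cycle C) (trans vₖ≡v (sym vᵢ≡v)))

    maximal⇒dominating : MaximalOddCycleIndependent G S → OddCycleDominating G S
    maximal⇒dominating maximal v v∉S =
      let cycleIn@(C , inT) = maximal⇒oddCycleIn-∪⁅⁆ maximal v∉S
          v-on = independent⇒onCycle (proj₁ maximal) cycleIn
          (u , u∈S , u-on) = otherVertexIn cycleIn v-on
      in u , u∈S , C , inT , u-on , v-on

    independent⇒¬dominating-⊂ : OddCycleIndependent G S →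
                                ∀ {T} → T ⊂ S → ¬ OddCycleDominating G T
    independent⇒¬dominating-⊂ independent (T⊆S , x , x∈S , x∉T) dominating =
      let (_ , _ , C , inT , _) = dominating x x∉T
      in independent C (∪⁅⁆-⊆ T⊆S x∈S ∘ inT)

mainTheorem14 : {n : ℕ} (G : Graph n) (S : Subset n) →
    MaximalOddCycleIndependent G S → MinimalOddCycleDominating G S
mainTheorem14 G S maximal =
    maximal⇒dominating G maximal
  , λ T T⊂S → independent⇒¬dominating-⊂ G (proj₁ maximal) T⊂S
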